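{- Let $$\widetilde{P}(x,u,q)=\sum_{k\geq 0}\sum_{n\geq k}\sum_{\pi\in P_{n,k}}\frac{x^nu^kq^{\mathrm{sumelements}(\pi)}}{n!}.$$ Then $$\frac{\partial}{\partial q}\widetilde{P}(x,u,q)\Big|_{u=q=1}=e^{e^x-1}\left(\frac{1}{3}e^{3x}-\frac{1}{2}xe^{2x}+\frac{3}{4}e^{2x}-xe^x-e^{x}-\frac{1}{12}\right).$$
   Context: A set partition of $[n]$ with exactly $k$ blocks is a collection $\{B_1,\dots,B_k\}$ of nonempty pairwise disjoint subsets with union $[n]$, indexed so that $\min B_1<\cdots<\min B_k$; $P_{n,k}$ is the set of such partitions ($P_{0,0}$ consists of the empty partition). A partition is identified with its canonical sequential form $\pi=\pi_1\cdots\pi_n$, where $i\in B_{\pi_i}$. An entry $\pi_i$ is a record if $\pi_i>\pi_j$ for all $j<i$; the records are the first occurrences of $1,\dots,k$. For $a\in[k]$, $\mathrm{sumelements}_a(\pi)$ is the sum of all entries of $\pi$ at positions strictly before the record $a$, and $\mathrm{sumelements}(\pi)=\sum_{a=1}^{k}\mathrm{sumelements}_a(\pi)$. The generating function is a formal power series in $x$ (exponential) and $u$, with polynomial coefficients in $q$. -}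

module Defs where

open import Data.Nat as ℕ using (ℕ; zero; suc; _!; _⊔_; _<ᵇ_)
open import Data.Nat.Properties using (_!≢0)
open import Data.Bool using (if_then_else_)
open import Data.Integer as ℤ using (ℤ)
open import Data.List using (List; []; _∷_; map; concatMap; upTo; foldr)
open import Data.Rational as ℚ using (ℚ; _+_; _*_; _-_; -_; 0ℚ; 1ℚ; _/_)

-- Set partitions in canonical sequential form (restricted growth
-- sequences).  `rgs n m` lists all sequences π₁⋯πₙ (as lists) that can
-- follow a prefix whose maximum entry is m, where each new entry is in
-- {1,…, current max + 1}.  `rgs n 0` is exactly the set of canonical
-- sequential forms of partitions of [n] (any number k of blocks;
-- k = max entry).

rgs : ℕ → ℕ → List (List ℕ)
rgs zero    m = [] ∷ []
rgs (suc n) m =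
  concatMap (λ v → map (v ∷_) (rgs n (m ⊔ v))) (map suc (upTo (suc m)))

partitions : ℕ → List (List ℕ)
partitions n = rgs n 0

blocks : List ℕ → ℕ
blocks = foldr _⊔_ 0

-- Scanning left to right with m = max of entries seen so
-- far and s = sum of entries seen so far: an entry v is a record iff
-- m < v, and then it contributes s = sum of entries strictly before it.

sumelementsAux : ℕ → ℕ → List ℕ → ℕ
sumelementsAux m s []       = 0
sumelementsAux m s (v ∷ vs) =
  (if m <ᵇ v then s else 0) ℕ.+ sumelementsAux (m ⊔ v) (s ℕ.+ v) vs

sumelements : List ℕ → ℕ
sumelements = sumelementsAux 0 0

-- Formal power series in x over ℚ, as coefficient sequences
-- (f n = [xⁿ] f).

PS : Set
PS = ℕ → ℚ

sumℚ : List ℚ → ℚ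
sumℚ = foldr _+_ 0ℚ

Σ≤ : ℕ → (ℕ → ℚ) → ℚ
Σ≤ n f = sumℚ (map f (upTo (suc n)))

_⊕_ : PS → PS → PS
(f ⊕ g) n = f n + g n

_⊖_ : PS → PS → PS
(f ⊖ g) n = f n - g n

_⊗_ : PS → PS → PS
(f ⊗ g) n = Σ≤ n (λ i → f i * g (n ℕ.∸ i))

_·_ : ℚ → PS → PS
(c · f) n = c * f n

const : ℚ → PS
const c zero    = c
const c (suc n) = 0ℚ

X : PS
X (suc zero) = 1ℚ
X _          = 0ℚ

pow : PS → ℕ → PS
pow f zero    = const 1ℚ
pow f (suc m) = f ⊗ pow f m

inv! : ℕ → ℚ
inv! n = (ℤ.+ 1) / (n !) where instance _ = n !≢0

-- e^{a x} for a natural number a : coefficients aⁿ / n!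
expX : ℕ → PS
expX a n = (ℤ.+ (a ℕ.^ n)) / (n !) where instance _ = n !≢0

-- exp(g) = Σ_m g^m / m!, for g with zero constant term (then only
-- m ≤ n contributes to [xⁿ], so the truncated sum is exact).
expS : PS → PS
expS g n = Σ≤ n (λ m → inv! m * pow g m n)

-- Left-hand side: ∂/∂q P̃(x,u,q) at u = q = 1.  The coefficient of xⁿ
-- in P̃ at u = 1 is (1/n!) Σ_{π ⊢ [n]} q^{sumelements π}; its q-derivative
-- at q = 1 is (1/n!) Σ_{π} sumelements π.

dPdq-at-1 : PS
dPdq-at-1 n = (ℤ.+ (foldr ℕ._+_ 0 (map sumelements (partitions n)))) / (n !)
  where instance _ = n !≢0

rat : ℤ → ℕ → ℚ
rat a zero    = 0ℚ
rat a (suc b) = a / suc b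

rhs : PS
rhs = expS (expX 1 ⊖ const 1ℚ) ⊗
      ((((((rat (ℤ.+ 1) 3 · expX 3)
         ⊖ (rat (ℤ.+ 1) 2 · (X ⊗ expX 2)))
         ⊕ (rat (ℤ.+ 3) 4 · expX 2))
         ⊖ (X ⊗ expX 1))
         ⊖ expX 1)
         ⊖ const (rat (ℤ.+ 1) 12))

{-# OPTIONS --safe #-}
module Submission where

-- Write Cₙ(m) for the number of ways to extend a restricted growth sequence of maximum m
-- by n entries, and Sₙ(m, s) for the total of sumelements over these extensions when the
-- prefix has entry sum s.  The next entry is one of the m old values or the new record
-- m + 1, so Cₙ₊₁(m) = m Cₙ(m) + Cₙ(m + 1), and Sₙ obeys a similar recurrence.  It is solved
-- by Sₙ(m, s) = s (Cₙ(m + 1) − Cₙ(m)) plus a quadratic in m whose coefficients are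
-- combinations of Cₙ(m + j) and n Cₙ₋₁(m + j).  On the analytic side Wⱼ = e^{e^x − 1} e^{jx}
-- satisfies Wⱼ′ = j Wⱼ + Wⱼ₊₁, the recurrence of Cₙ(j) / n!, so [xⁿ] Wⱼ = Cₙ(j) / n! and
-- [xⁿ] x Wⱼ = n Cₙ₋₁(j) / n!.  At m = s = 0 the closed form is therefore n! times the
-- coefficient of xⁿ on the right-hand side.

open import Defs
open import Data.Nat using (ℕ)
open import Relation.Binary.PropositionalEquality using (_≡_)

open import Algebra.Bundles using (Ring; CommutativeMonoid)
open import Data.Fin using (toℕ; #_)
open import Data.Fin.Properties using (toℕ<n; toℕ-inject₁; toℕ-fromℕ)
import Data.Integer.Base as ℤ
import Data.Integer.Properties as ℤ
open import Data.List.Base using (List; []; _∷_; _++_; map; concatMap; applyUpTo; upTo; foldr)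
import Data.List.Properties as List
open import Data.Nat.Base as ℕ using (zero; suc; _!; _∸_; _≤_; _<_; _≤′_; ≤′-refl; ≤′-step; _⊔_; _<ᵇ_; s≤s)
import Data.Nat.Properties as ℕ
open import Data.Nat.Properties using (_!≢0)
open import Data.Rational.Base using (ℚ; _+_; _*_; _-_; -_; 0ℚ; 1ℚ; _/_; fromℚᵘ)
import Data.Rational.Properties as ℚ
open import Data.Rational.Solver using (module +-*-Solver)
open import Data.Rational.Unnormalised.Base as ℚᵘ using (mkℚᵘ; *≡*)
import Data.Rational.Unnormalised.Properties as ℚᵘ
open import Data.Vec.Base using ([]; _∷_)
open import Data.Bool.Base using (true; false; if_then_else_)
open import Function.Base using (_∘_)
open import Relation.Binary.PropositionalEquality
  using (refl; sym; trans; cong; cong₂; _≗_; module ≡-Reasoning)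

open import Algebra.Properties.Semiring.Sum (Ring.semiring ℚ.+-*-ring)
  using (sum; sum-cong-≗; sum-replicate; sum-replicate-zero; sum-init-last; ∑-distrib-+; ∑-comm; *-distribˡ-sum; *-distribʳ-sum)
open import Algebra.Properties.Semiring.Mult (Ring.semiring ℚ.+-*-ring)
  using (_×_; ×-homo-+; ×1-homo-*; ×-assoc-*)
open +-*-Solver using (solve; Polynomial; var; ⟦_⟧; _:+_; _:*_; _:-_; _:=_; con)
open import Algebra.Properties.CommutativeSemigroup (CommutativeMonoid.commutativeSemigroup ℚ.*-1-commutativeMonoid)
  using (x∙yz≈y∙xz)
open ≡-Reasoning

infix 21 ↑_

-- Repeated addition, so that ↑ (suc n) is definitionally 1ℚ + ↑ n.
↑_ : ℕ → ℚ
↑ n = n × 1ℚ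

↑-+ : ∀ m n → ↑ (m ℕ.+ n) ≡ ↑ m + ↑ n
↑-+ = ×-homo-+ 1ℚ

↑-* : ∀ m n → ↑ (m ℕ.* n) ≡ ↑ m * ↑ n
↑-* = ×1-homo-*

↑-∸ : ∀ {i n} → i ≤ n → ↑ n ≡ ↑ i + ↑ (n ∸ i)
↑-∸ {i} {n} i≤n = trans (cong ↑_ (sym (ℕ.m+[n∸m]≡n i≤n))) (↑-+ i (n ∸ i))

fromℚᵘ-homo-+ : ∀ p q → fromℚᵘ (p ℚᵘ.+ q) ≡ fromℚᵘ p + fromℚᵘ q
fromℚᵘ-homo-+ p q = ℚ.toℚᵘ-injective (ℚᵘ.≃-trans (ℚ.toℚᵘ-fromℚᵘ (p ℚᵘ.+ q))
  (ℚᵘ.≃-sym (ℚᵘ.≃-trans (ℚ.toℚᵘ-homo-+ (fromℚᵘ p) (fromℚᵘ q))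
    (ℚᵘ.+-cong (ℚ.toℚᵘ-fromℚᵘ p) (ℚ.toℚᵘ-fromℚᵘ q)))))

fromℚᵘ-homo-* : ∀ p q → fromℚᵘ (p ℚᵘ.* q) ≡ fromℚᵘ p * fromℚᵘ q
fromℚᵘ-homo-* p q = ℚ.toℚᵘ-injective (ℚᵘ.≃-trans (ℚ.toℚᵘ-fromℚᵘ (p ℚᵘ.* q))
  (ℚᵘ.≃-sym (ℚᵘ.≃-trans (ℚ.toℚᵘ-homo-* (fromℚᵘ p) (fromℚᵘ q))
    (ℚᵘ.*-cong (ℚ.toℚᵘ-fromℚᵘ p) (ℚ.toℚᵘ-fromℚᵘ q)))))

↑-as-fraction : ∀ n → ↑ n ≡ ℤ.+ n / 1
↑-as-fraction zero    = refl
↑-as-fraction (suc n) = begin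
  1ℚ + ↑ n                                              ≡⟨ cong (1ℚ +_) (↑-as-fraction n) ⟩
  fromℚᵘ (mkℚᵘ (ℤ.+ 1) 0) + fromℚᵘ (mkℚᵘ (ℤ.+ n) 0)  ≡⟨ fromℚᵘ-homo-+ (mkℚᵘ (ℤ.+ 1) 0) (mkℚᵘ (ℤ.+ n) 0) ⟨
  fromℚᵘ (mkℚᵘ (ℤ.+ 1) 0 ℚᵘ.+ mkℚᵘ (ℤ.+ n) 0)         ≡⟨ ℚ.fromℚᵘ-cong {mkℚᵘ (ℤ.+ 1) 0 ℚᵘ.+ mkℚᵘ (ℤ.+ n) 0} {mkℚᵘ (ℤ.+ suc n) 0} (*≡* eq) ⟩
  fromℚᵘ (mkℚᵘ (ℤ.+ suc n) 0)                          ∎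
  where
  eq : (ℤ.+ 1 ℤ.* ℤ.+ 1 ℤ.+ ℤ.+ n ℤ.* ℤ.+ 1) ℤ.* ℤ.+ 1 ≡ ℤ.+ suc n ℤ.* ℤ.+ (1 ℕ.* 1)
  eq = cong (λ t → (ℤ.+ 1 ℤ.+ t) ℤ.* ℤ.+ 1) (ℤ.*-identityʳ (ℤ.+ n))

fraction-as-* : ∀ a d .{{_ : ℕ.NonZero d}} → ℤ.+ a / d ≡ ↑ a * (ℤ.+ 1 / d)
fraction-as-* a (suc k) = begin
  fromℚᵘ (mkℚᵘ (ℤ.+ a) k)                              ≡⟨ ℚ.fromℚᵘ-cong {mkℚᵘ (ℤ.+ a) k} {mkℚᵘ (ℤ.+ a) 0 ℚᵘ.* mkℚᵘ (ℤ.+ 1) k} (*≡* eq) ⟩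
  fromℚᵘ (mkℚᵘ (ℤ.+ a) 0 ℚᵘ.* mkℚᵘ (ℤ.+ 1) k)         ≡⟨ fromℚᵘ-homo-* (mkℚᵘ (ℤ.+ a) 0) (mkℚᵘ (ℤ.+ 1) k) ⟩
  fromℚᵘ (mkℚᵘ (ℤ.+ a) 0) * fromℚᵘ (mkℚᵘ (ℤ.+ 1) k)  ≡⟨ cong (_* fromℚᵘ (mkℚᵘ (ℤ.+ 1) k)) (↑-as-fraction a) ⟨
  ↑ a * (ℤ.+ 1 / suc k)                                  ∎
  where
  eq : ℤ.+ a ℤ.* ℤ.+ (1 ℕ.* suc k) ≡ (ℤ.+ a ℤ.* ℤ.+ 1) ℤ.* ℤ.+ suc k
  eq = cong₂ ℤ._*_ (sym (ℤ.*-identityʳ (ℤ.+ a))) (cong ℤ.+_ (ℕ.*-identityˡ (suc k)))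

↑-*-fraction-cancel : ∀ a d .{{_ : ℕ.NonZero d}} .{{_ : ℕ.NonZero (suc a ℕ.* d)}} →
                      ↑ (suc a) * (ℤ.+ 1 / (suc a ℕ.* d)) ≡ ℤ.+ 1 / d
↑-*-fraction-cancel a (suc k) = begin
  ↑ (suc a) * fromℚᵘ (mkℚᵘ (ℤ.+ 1) l)                ≡⟨ cong (_* fromℚᵘ (mkℚᵘ (ℤ.+ 1) l)) (↑-as-fraction (suc a)) ⟩
  fromℚᵘ (mkℚᵘ (ℤ.+ suc a) 0) * fromℚᵘ (mkℚᵘ (ℤ.+ 1) l)  ≡⟨ fromℚᵘ-homo-* (mkℚᵘ (ℤ.+ suc a) 0) (mkℚᵘ (ℤ.+ 1) l) ⟨
  fromℚᵘ (mkℚᵘ (ℤ.+ suc a) 0 ℚᵘ.* mkℚᵘ (ℤ.+ 1) l)     ≡⟨ ℚ.fromℚᵘ-cong {mkℚᵘ (ℤ.+ suc a) 0 ℚᵘ.* mkℚᵘ (ℤ.+ 1) l} {mkℚᵘ (ℤ.+ 1) k} (*≡* eq) ⟩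
  fromℚᵘ (mkℚᵘ (ℤ.+ 1) k)                              ∎
  where
  l = k ℕ.+ a ℕ.* suc k
  eq : (ℤ.+ suc a ℤ.* ℤ.+ 1) ℤ.* ℤ.+ suc k ≡ ℤ.+ 1 ℤ.* ℤ.+ (1 ℕ.* (suc a ℕ.* suc k))
  eq = begin
    (ℤ.+ suc a ℤ.* ℤ.+ 1) ℤ.* ℤ.+ suc k  ≡⟨ cong (ℤ._* ℤ.+ suc k) (ℤ.*-identityʳ (ℤ.+ suc a)) ⟩
    ℤ.+ suc a ℤ.* ℤ.+ suc k              ≡⟨ ℤ.pos-* (suc a) (suc k) ⟨
    ℤ.+ (suc a ℕ.* suc k)                ≡⟨ cong ℤ.+_ (ℕ.*-identityˡ (suc a ℕ.* suc k)) ⟨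
    ℤ.+ (1 ℕ.* (suc a ℕ.* suc k))        ≡⟨ ℤ.*-identityˡ _ ⟨
    ℤ.+ 1 ℤ.* ℤ.+ (1 ℕ.* (suc a ℕ.* suc k))  ∎

inv!-suc : ∀ n → ↑ (suc n) * inv! (suc n) ≡ inv! n
inv!-suc n = ↑-*-fraction-cancel n (n !) {{n !≢0}} {{suc n !≢0}}

*-cancelˡ-↑suc : ∀ n {x y} → ↑ (suc n) * x ≡ ↑ (suc n) * y → x ≡ y
*-cancelˡ-↑suc n {x} {y} eq = begin
  x                   ≡⟨ ℚ.*-identityˡ x ⟨
  1ℚ * x              ≡⟨ cong (_* x) inverse ⟨
  (r * ↑ (suc n)) * x ≡⟨ ℚ.*-assoc r _ x ⟩
  r * (↑ (suc n) * x) ≡⟨ cong (r *_) eq ⟩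
  r * (↑ (suc n) * y) ≡⟨ ℚ.*-assoc r _ y ⟨
  (r * ↑ (suc n)) * y ≡⟨ cong (_* y) inverse ⟩
  1ℚ * y              ≡⟨ ℚ.*-identityˡ y ⟩
  y                   ∎
  where
  r = ℤ.+ 1 / (suc n ℕ.* 1)
  inverse : r * ↑ (suc n) ≡ 1ℚ
  inverse = trans (ℚ.*-comm r _) (↑-*-fraction-cancel n 1)

-- Opaque, so that the summand of a sum can be recovered by unification.
opaque
  ∑< : ℕ → (ℕ → ℚ) → ℚ
  ∑< N f = sum {N} (f ∘ toℕ)

  ∑<-empty : ∀ {f} → ∑< 0 f ≡ 0ℚ
  ∑<-empty = refl

  ∑<-suc : ∀ N {f} → ∑< (suc N) f ≡ f 0 + ∑< N (f ∘ suc)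
  ∑<-suc N = refl

  ∑<-cong : ∀ N {f g} → (∀ i → i < N → f i ≡ g i) → ∑< N f ≡ ∑< N g
  ∑<-cong N f≡g = sum-cong-≗ (λ i → f≡g (toℕ i) (toℕ<n i))

  ∑<-zero : ∀ N {f} → (∀ i → i < N → f i ≡ 0ℚ) → ∑< N f ≡ 0ℚ
  ∑<-zero N f≡0 = trans (∑<-cong N f≡0) (sum-replicate-zero N)

  ∑<-+ : ∀ N {f g} → ∑< N (λ i → f i + g i) ≡ ∑< N f + ∑< N g
  ∑<-+ N {f} {g} = ∑-distrib-+ {N} (f ∘ toℕ) (g ∘ toℕ)

  ∑<-neg : ∀ N {f} → ∑< N (λ i → - f i) ≡ - ∑< N f
  ∑<-neg zero    = refl
  ∑<-neg (suc N) {f} = trans (cong (- f 0 +_) (∑<-neg N {f ∘ suc})) (sym (ℚ.neg-distrib-+ (f 0) _))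

  ∑<-*ˡ : ∀ N c {f} → c * ∑< N f ≡ ∑< N (λ i → c * f i)
  ∑<-*ˡ N c {f} = *-distribˡ-sum {N} c (f ∘ toℕ)

  ∑<-*ʳ : ∀ N c {f} → ∑< N f * c ≡ ∑< N (λ i → f i * c)
  ∑<-*ʳ N c {f} = *-distribʳ-sum {N} c (f ∘ toℕ)

  ∑<-comm : ∀ M N (F : ℕ → ℕ → ℚ) → ∑< M (λ i → ∑< N (F i)) ≡ ∑< N (λ j → ∑< M (λ i → F i j))
  ∑<-comm M N F = ∑-comm {M} {N} (λ i j → F (toℕ i) (toℕ j))

  ∑<-const : ∀ N c → ∑< N (λ _ → c) ≡ ↑ N * c
  ∑<-const N c = begin
    sum {N} (λ _ → c)  ≡⟨ sum-replicate N ⟩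
    N × c              ≡⟨ cong (N ×_) (ℚ.*-identityˡ c) ⟨
    N × (1ℚ * c)       ≡⟨ ×-assoc-* N 1ℚ c ⟨
    ↑ N * c            ∎

  ∑<-snoc : ∀ N {f} → ∑< (suc N) f ≡ ∑< N f + f N
  ∑<-snoc N {f} = trans (sum-init-last {N} (f ∘ toℕ))
    (cong₂ _+_ (sum-cong-≗ {N} (cong f ∘ toℕ-inject₁)) (cong f (toℕ-fromℕ N)))

∑<-extend : ∀ {a b} f → (∀ k → a ≤ k → k < b → f k ≡ 0ℚ) → a ≤ b → ∑< b f ≡ ∑< a f
∑<-extend f f≡0 a≤b = go f≡0 (ℕ.≤⇒≤′ a≤b)
  where
  go : ∀ {a b} → (∀ k → a ≤ k → k < b → f k ≡ 0ℚ) → a ≤′ b → ∑< b f ≡ ∑< a f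
  go f≡0 ≤′-refl = refl
  go {a} {suc b} f≡0 (≤′-step a≤′b) = begin
    ∑< (suc b) f   ≡⟨ ∑<-snoc b ⟩
    ∑< b f + f b   ≡⟨ cong (∑< b f +_) (f≡0 b (ℕ.≤′⇒≤ a≤′b) ℕ.≤-refl) ⟩
    ∑< b f + 0ℚ    ≡⟨ ℚ.+-identityʳ _ ⟩
    ∑< b f         ≡⟨ go (λ k a≤k k<b → f≡0 k a≤k (ℕ.m<n⇒m<1+n k<b)) a≤′b ⟩
    ∑< a f         ∎

∑<-reverse : ∀ N f → ∑< N f ≡ ∑< N (λ i → f (N ∸ suc i))
∑<-reverse zero    f = trans ∑<-empty (sym ∑<-empty)
∑<-reverse (suc N) f = begin
  ∑< (suc N) f                          ≡⟨ ∑<-snoc N ⟩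
  ∑< N f + f N                          ≡⟨ cong (_+ f N) (∑<-reverse N f) ⟩
  ∑< N (λ i → f (N ∸ suc i)) + f N      ≡⟨ ℚ.+-comm _ (f N) ⟩
  f N + ∑< N (λ i → f (N ∸ suc i))      ≡⟨ ∑<-suc N ⟨
  ∑< (suc N) (λ i → f (suc N ∸ suc i))  ∎

∑<-triangle : ∀ n (F : ℕ → ℕ → ℚ) →
              ∑< (suc n) (λ i → ∑< (suc i) (λ j → F j (i ∸ j))) ≡ ∑< (suc n) (λ j → ∑< (suc (n ∸ j)) (F j))
∑<-triangle zero    F = ∑<-cong 1 λ { zero _ → ∑<-cong 1 λ { zero _ → refl ; (suc _) (s≤s ()) } ; (suc _) (s≤s ()) }
∑<-triangle (suc n) F = begin
  ∑< (2 ℕ.+ n) (λ i → ∑< (suc i) (λ j → F j (i ∸ j)))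
    ≡⟨ ∑<-suc (suc n) ⟩
  ∑< 1 (λ j → F j (0 ∸ j)) + ∑< (suc n) (λ i → ∑< (2 ℕ.+ i) (λ j → F j (suc i ∸ j)))
    ≡⟨ cong₂ _+_ (∑<-suc 0) (∑<-cong (suc n) (λ i _ → ∑<-suc (suc i))) ⟩
  (F 0 0 + ∑< 0 (λ j → F (suc j) 0)) + ∑< (suc n) (λ i → F 0 (suc i) + ∑< (suc i) (λ j → F (suc j) (i ∸ j)))
    ≡⟨ cong₂ _+_ (cong (F 0 0 +_) ∑<-empty) (∑<-+ (suc n)) ⟩
  (F 0 0 + 0ℚ) + (∑< (suc n) (F 0 ∘ suc) + ∑< (suc n) (λ i → ∑< (suc i) (λ j → F (suc j) (i ∸ j))))
    ≡⟨ cong (λ t → (F 0 0 + 0ℚ) + (∑< (suc n) (F 0 ∘ suc) + t)) (∑<-triangle n (F ∘ suc)) ⟩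
  (F 0 0 + 0ℚ) + (∑< (suc n) (F 0 ∘ suc) + ∑< (suc n) (λ j → ∑< (suc (n ∸ j)) (F (suc j))))
    ≡⟨ regroup (F 0 0) _ _ ⟩
  (F 0 0 + ∑< (suc n) (F 0 ∘ suc)) + ∑< (suc n) (λ j → ∑< (suc (n ∸ j)) (F (suc j)))
    ≡⟨ cong (_+ ∑< (suc n) (λ j → ∑< (suc (n ∸ j)) (F (suc j)))) (∑<-suc (suc n)) ⟨
  ∑< (2 ℕ.+ n) (F 0) + ∑< (suc n) (λ j → ∑< (suc (n ∸ j)) (F (suc j)))
    ≡⟨ ∑<-suc (suc n) ⟨
  ∑< (2 ℕ.+ n) (λ j → ∑< (suc (suc n ∸ j)) (F j))
    ∎
  where
  regroup : ∀ a b c → (a + 0ℚ) + (b + c) ≡ (a + b) + c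
  regroup = solve 3 (λ a b c → (a :+ con 0ℚ) :+ (b :+ c) := (a :+ b) :+ c) refl

∑ₗ : ∀ {A : Set} → List A → (A → ℚ) → ℚ
∑ₗ L φ = sumℚ (map φ L)

∑ₗ-cong : ∀ {A : Set} (L : List A) {φ ψ} → φ ≗ ψ → ∑ₗ L φ ≡ ∑ₗ L ψ
∑ₗ-cong L φ≗ψ = cong sumℚ (List.map-cong φ≗ψ L)

∑ₗ-map : ∀ {A B : Set} (f : A → B) L φ → ∑ₗ (map f L) φ ≡ ∑ₗ L (φ ∘ f)
∑ₗ-map f L φ = cong sumℚ (sym (List.map-∘ L))

∑ₗ-++ : ∀ {A : Set} (xs ys : List A) φ → ∑ₗ (xs ++ ys) φ ≡ ∑ₗ xs φ + ∑ₗ ys φ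
∑ₗ-++ []       ys φ = sym (ℚ.+-identityˡ _)
∑ₗ-++ (x ∷ xs) ys φ = trans (cong (φ x +_) (∑ₗ-++ xs ys φ)) (sym (ℚ.+-assoc (φ x) _ _))

∑ₗ-concatMap : ∀ {A B : Set} (G : A → List B) L φ → ∑ₗ (concatMap G L) φ ≡ ∑ₗ L (λ v → ∑ₗ (G v) φ)
∑ₗ-concatMap G []      φ = refl
∑ₗ-concatMap G (v ∷ L) φ = trans (∑ₗ-++ (G v) (concatMap G L) φ) (cong (∑ₗ (G v) φ +_) (∑ₗ-concatMap G L φ))

∑ₗ-const-+ : ∀ {A : Set} (L : List A) c ψ → ∑ₗ L (λ x → c + ψ x) ≡ c * ∑ₗ L (λ _ → 1ℚ) + ∑ₗ L ψ
∑ₗ-const-+ []      c ψ = solve 1 (λ c → con 0ℚ := c :* con 0ℚ :+ con 0ℚ) refl c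
∑ₗ-const-+ (x ∷ L) c ψ = trans (cong (c + ψ x +_) (∑ₗ-const-+ L c ψ))
  (solve 4 (λ c y a b → c :+ y :+ (c :* a :+ b) := c :* (con 1ℚ :+ a) :+ (y :+ b)) refl c (ψ x) _ _)

∑ₗ-applyUpTo : ∀ {A : Set} (f : ℕ → A) N φ → ∑ₗ (applyUpTo f N) φ ≡ ∑< N (φ ∘ f)
∑ₗ-applyUpTo f zero    φ = sym ∑<-empty
∑ₗ-applyUpTo f (suc N) φ = trans (cong (φ (f 0) +_) (∑ₗ-applyUpTo (f ∘ suc) N φ)) (sym (∑<-suc N))

Σ≤-as-∑< : ∀ n f → Σ≤ n f ≡ ∑< (suc n) f
Σ≤-as-∑< n f = ∑ₗ-applyUpTo (λ i → i) (suc n) f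

⊗-as-∑ : ∀ f g n → (f ⊗ g) n ≡ ∑< (suc n) (λ i → f i * g (n ∸ i))
⊗-as-∑ f g n = Σ≤-as-∑< n (λ i → f i * g (n ∸ i))

⊗-cong : ∀ {f f′ g g′} → f ≗ f′ → g ≗ g′ → f ⊗ g ≗ f′ ⊗ g′
⊗-cong f≗f′ g≗g′ n = cong sumℚ (List.map-cong (λ i → cong₂ _*_ (f≗f′ i) (g≗g′ (n ∸ i))) (upTo (suc n)))

⊗-congˡ : ∀ {f f′} g → f ≗ f′ → f ⊗ g ≗ f′ ⊗ g
⊗-congˡ g f≗f′ = ⊗-cong f≗f′ (λ _ → refl)

⊗-congʳ : ∀ f {g g′} → g ≗ g′ → f ⊗ g ≗ f ⊗ g′
⊗-congʳ f g≗g′ = ⊗-cong {f = f} (λ _ → refl) g≗g′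

⊗-congʳ-≤ : ∀ f {g g′} n → (∀ k → k ≤ n → g k ≡ g′ k) → (f ⊗ g) n ≡ (f ⊗ g′) n
⊗-congʳ-≤ f {g} {g′} n g≡g′ = begin
  (f ⊗ g) n                              ≡⟨ ⊗-as-∑ f g n ⟩
  ∑< (suc n) (λ i → f i * g (n ∸ i))     ≡⟨ ∑<-cong (suc n) (λ i _ → cong (f i *_) (g≡g′ (n ∸ i) (ℕ.m∸n≤m n i))) ⟩
  ∑< (suc n) (λ i → f i * g′ (n ∸ i))    ≡⟨ ⊗-as-∑ f g′ n ⟨
  (f ⊗ g′) n                             ∎

⊗-comm : ∀ f g → f ⊗ g ≗ g ⊗ f
⊗-comm f g n = begin
  (f ⊗ g) n                                           ≡⟨ ⊗-as-∑ f g n ⟩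
  ∑< (suc n) (λ i → f i * g (n ∸ i))                  ≡⟨ ∑<-reverse (suc n) (λ i → f i * g (n ∸ i)) ⟩
  ∑< (suc n) (λ i → f (n ∸ i) * g (n ∸ (n ∸ i)))      ≡⟨ ∑<-cong (suc n) swap ⟩
  ∑< (suc n) (λ i → g i * f (n ∸ i))                  ≡⟨ ⊗-as-∑ g f n ⟨
  (g ⊗ f) n                                           ∎
  where
  swap : ∀ i → i < suc n → f (n ∸ i) * g (n ∸ (n ∸ i)) ≡ g i * f (n ∸ i)
  swap i i<1+n = trans (cong (λ k → f (n ∸ i) * g k) (ℕ.m∸[m∸n]≡n (ℕ.≤-pred i<1+n))) (ℚ.*-comm (f (n ∸ i)) (g i))

⊗-assoc : ∀ f g h → (f ⊗ g) ⊗ h ≗ f ⊗ (g ⊗ h)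
⊗-assoc f g h n = begin
  ((f ⊗ g) ⊗ h) n                                      ≡⟨ ⊗-as-∑ (f ⊗ g) h n ⟩
  ∑< (suc n) (λ i → (f ⊗ g) i * h (n ∸ i))             ≡⟨ ∑<-cong (suc n) (λ i _ → expand i) ⟩
  ∑< (suc n) (λ i → ∑< (suc i) (λ j → F j (i ∸ j)))    ≡⟨ ∑<-triangle n F ⟩
  ∑< (suc n) (λ j → ∑< (suc (n ∸ j)) (F j))            ≡⟨ ∑<-cong (suc n) (λ j _ → collect j) ⟩
  ∑< (suc n) (λ j → f j * (g ⊗ h) (n ∸ j))             ≡⟨ ⊗-as-∑ f (g ⊗ h) n ⟨
  (f ⊗ (g ⊗ h)) n                                      ∎
  where
  F : ℕ → ℕ → ℚ
  F j k = f j * (g k * h (n ∸ j ∸ k))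
  expand : ∀ i → (f ⊗ g) i * h (n ∸ i) ≡ ∑< (suc i) (λ j → F j (i ∸ j))
  expand i = begin
    (f ⊗ g) i * h (n ∸ i)                             ≡⟨ cong (_* h (n ∸ i)) (⊗-as-∑ f g i) ⟩
    ∑< (suc i) (λ j → f j * g (i ∸ j)) * h (n ∸ i)    ≡⟨ ∑<-*ʳ (suc i) (h (n ∸ i)) ⟩
    ∑< (suc i) (λ j → f j * g (i ∸ j) * h (n ∸ i))    ≡⟨ ∑<-cong (suc i) reassociate ⟩
    ∑< (suc i) (λ j → F j (i ∸ j))                    ∎
    where
    reassociate : ∀ j → j < suc i → f j * g (i ∸ j) * h (n ∸ i) ≡ F j (i ∸ j)
    reassociate j j<1+i = trans (ℚ.*-assoc (f j) _ _) (cong (λ k → f j * (g (i ∸ j) * h k)) (sym (begin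
      n ∸ j ∸ (i ∸ j)    ≡⟨ ℕ.∸-+-assoc n j (i ∸ j) ⟩
      n ∸ (j ℕ.+ (i ∸ j)) ≡⟨ cong (n ∸_) (ℕ.m+[n∸m]≡n (ℕ.≤-pred j<1+i)) ⟩
      n ∸ i              ∎)))
  collect : ∀ j → ∑< (suc (n ∸ j)) (F j) ≡ f j * (g ⊗ h) (n ∸ j)
  collect j = trans (sym (∑<-*ˡ (suc (n ∸ j)) (f j))) (cong (f j *_) (sym (⊗-as-∑ g h (n ∸ j))))

⊗-left-comm : ∀ f g h → f ⊗ (g ⊗ h) ≗ g ⊗ (f ⊗ h)
⊗-left-comm f g h n = begin
  (f ⊗ (g ⊗ h)) n  ≡⟨ ⊗-assoc f g h n ⟨
  ((f ⊗ g) ⊗ h) n  ≡⟨ ⊗-congˡ h (⊗-comm f g) n ⟩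
  ((g ⊗ f) ⊗ h) n  ≡⟨ ⊗-assoc g f h n ⟩
  (g ⊗ (f ⊗ h)) n  ∎

⊗-distribˡ-⊕ : ∀ f g h → f ⊗ (g ⊕ h) ≗ (f ⊗ g) ⊕ (f ⊗ h)
⊗-distribˡ-⊕ f g h n = begin
  (f ⊗ (g ⊕ h)) n                                                          ≡⟨ ⊗-as-∑ f (g ⊕ h) n ⟩
  ∑< (suc n) (λ i → f i * (g (n ∸ i) + h (n ∸ i)))                         ≡⟨ ∑<-cong (suc n) (λ i _ → ℚ.*-distribˡ-+ (f i) _ _) ⟩
  ∑< (suc n) (λ i → f i * g (n ∸ i) + f i * h (n ∸ i))                     ≡⟨ ∑<-+ (suc n) ⟩
  ∑< (suc n) (λ i → f i * g (n ∸ i)) + ∑< (suc n) (λ i → f i * h (n ∸ i))  ≡⟨ cong₂ _+_ (⊗-as-∑ f g n) (⊗-as-∑ f h n) ⟨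
  (f ⊗ g) n + (f ⊗ h) n                                                    ∎

⊗-distribˡ-⊖ : ∀ f g h → f ⊗ (g ⊖ h) ≗ (f ⊗ g) ⊖ (f ⊗ h)
⊗-distribˡ-⊖ f g h n = begin
  (f ⊗ (g ⊖ h)) n                           ≡⟨ ⊗-distribˡ-⊕ f g (λ k → - h k) n ⟩
  (f ⊗ g) n + (f ⊗ (λ k → - h k)) n         ≡⟨ cong ((f ⊗ g) n +_) negate ⟩
  (f ⊗ g) n - (f ⊗ h) n                     ∎
  where
  negate : (f ⊗ (λ k → - h k)) n ≡ - (f ⊗ h) n
  negate = begin
    (f ⊗ (λ k → - h k)) n                      ≡⟨ ⊗-as-∑ f (λ k → - h k) n ⟩
    ∑< (suc n) (λ i → f i * - h (n ∸ i))       ≡⟨ ∑<-cong (suc n) (λ i _ → sym (ℚ.neg-distribʳ-* (f i) _)) ⟩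
    ∑< (suc n) (λ i → - (f i * h (n ∸ i)))     ≡⟨ ∑<-neg (suc n) ⟩
    - ∑< (suc n) (λ i → f i * h (n ∸ i))       ≡⟨ cong -_ (⊗-as-∑ f h n) ⟨
    - (f ⊗ h) n                                ∎

⊗-·ʳ : ∀ f c g → f ⊗ (c · g) ≗ c · (f ⊗ g)
⊗-·ʳ f c g n = begin
  (f ⊗ (c · g)) n                           ≡⟨ ⊗-as-∑ f (c · g) n ⟩
  ∑< (suc n) (λ i → f i * (c * g (n ∸ i)))  ≡⟨ ∑<-cong (suc n) (λ i _ → x∙yz≈y∙xz (f i) c _) ⟩
  ∑< (suc n) (λ i → c * (f i * g (n ∸ i)))  ≡⟨ ∑<-*ˡ (suc n) c ⟨
  c * ∑< (suc n) (λ i → f i * g (n ∸ i))    ≡⟨ cong (c *_) (⊗-as-∑ f g n) ⟨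
  c * (f ⊗ g) n                             ∎

⊗-·ˡ : ∀ c f g → (c · f) ⊗ g ≗ c · (f ⊗ g)
⊗-·ˡ c f g n = begin
  ((c · f) ⊗ g) n  ≡⟨ ⊗-comm (c · f) g n ⟩
  (g ⊗ (c · f)) n  ≡⟨ ⊗-·ʳ g c f n ⟩
  c * (g ⊗ f) n    ≡⟨ cong (c *_) (⊗-comm g f n) ⟩
  c * (f ⊗ g) n    ∎

⊗-zeroʳ : ∀ f {g} → (∀ k → g k ≡ 0ℚ) → ∀ n → (f ⊗ g) n ≡ 0ℚ
⊗-zeroʳ f {g} g≡0 n = trans (⊗-as-∑ f g n) (∑<-zero (suc n) (λ i _ → trans (cong (f i *_) (g≡0 (n ∸ i))) (ℚ.*-zeroʳ (f i))))

⊗-constʳ : ∀ f c n → (f ⊗ const c) n ≡ f n * c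
⊗-constʳ f c n = begin
  (f ⊗ const c) n                                               ≡⟨ ⊗-as-∑ f (const c) n ⟩
  ∑< (suc n) (λ i → f i * const c (n ∸ i))                      ≡⟨ ∑<-snoc n ⟩
  ∑< n (λ i → f i * const c (n ∸ i)) + f n * const c (n ∸ n)    ≡⟨ cong₂ _+_ (∑<-zero n below) (cong (λ k → f n * const c k) (ℕ.n∸n≡0 n)) ⟩
  0ℚ + f n * c                                                  ≡⟨ ℚ.+-identityˡ _ ⟩
  f n * c                                                       ∎
  where
  below : ∀ i → i < n → f i * const c (n ∸ i) ≡ 0ℚ
  below i i<n = trans (cong (λ k → f i * const c k) (ℕ.+-∸-assoc 1 i<n)) (ℚ.*-zeroʳ (f i))

X-⊗-zero : ∀ f → (X ⊗ f) 0 ≡ 0ℚ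
X-⊗-zero f = trans (ℚ.+-identityʳ _) (ℚ.*-zeroˡ (f 0))

X-⊗-suc : ∀ f n → (X ⊗ f) (suc n) ≡ f n
X-⊗-suc f n = begin
  (X ⊗ f) (suc n)
    ≡⟨ ⊗-as-∑ X f (suc n) ⟩
  ∑< (2 ℕ.+ n) (λ i → X i * f (suc n ∸ i))
    ≡⟨ ∑<-suc (suc n) ⟩
  0ℚ * f (suc n) + ∑< (suc n) (λ i → X (suc i) * f (n ∸ i))
    ≡⟨ cong (0ℚ * f (suc n) +_) (∑<-suc n) ⟩
  0ℚ * f (suc n) + (1ℚ * f n + ∑< n (λ i → 0ℚ * f (n ∸ suc i)))
    ≡⟨ cong (λ t → 0ℚ * f (suc n) + (1ℚ * f n + t)) (∑<-zero n (λ i _ → ℚ.*-zeroˡ (f (n ∸ suc i)))) ⟩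
  0ℚ * f (suc n) + (1ℚ * f n + 0ℚ)
    ≡⟨ solve 2 (λ a b → con 0ℚ :* a :+ (con 1ℚ :* b :+ con 0ℚ) := b) refl (f (suc n)) (f n) ⟩
  f n
    ∎

⊗-∑ʳ : ∀ f N (h : ℕ → PS) n → (f ⊗ (λ k → ∑< N (λ m → h m k))) n ≡ ∑< N (λ m → (f ⊗ h m) n)
⊗-∑ʳ f N h n = begin
  (f ⊗ (λ k → ∑< N (λ m → h m k))) n                    ≡⟨ ⊗-as-∑ f (λ k → ∑< N (λ m → h m k)) n ⟩
  ∑< (suc n) (λ i → f i * ∑< N (λ m → h m (n ∸ i)))     ≡⟨ ∑<-cong (suc n) (λ i _ → ∑<-*ˡ N (f i)) ⟩
  ∑< (suc n) (λ i → ∑< N (λ m → f i * h m (n ∸ i)))     ≡⟨ ∑<-comm (suc n) N (λ i m → f i * h m (n ∸ i)) ⟩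
  ∑< N (λ m → ∑< (suc n) (λ i → f i * h m (n ∸ i)))     ≡⟨ ∑<-cong N (λ m _ → ⊗-as-∑ f (h m) n) ⟨
  ∑< N (λ m → (f ⊗ h m) n)                              ∎

-- Formal derivatives

∂ : PS → PS
∂ f n = ↑ (suc n) * f (suc n)

∂-const : ∀ c n → ∂ (const c) n ≡ 0ℚ
∂-const c n = ℚ.*-zeroʳ (↑ (suc n))

∂-⊖ : ∀ f g → ∂ (f ⊖ g) ≗ ∂ f ⊖ ∂ g
∂-⊖ f g n = solve 3 (λ a x y → a :* (x :- y) := a :* x :- a :* y) refl (↑ (suc n)) (f (suc n)) (g (suc n))

∂-⊗ : ∀ f g → ∂ (f ⊗ g) ≗ (∂ f ⊗ g) ⊕ (f ⊗ ∂ g)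
∂-⊗ f g n = begin
  ↑ (suc n) * (f ⊗ g) (suc n)                                          ≡⟨ cong (↑ (suc n) *_) (⊗-as-∑ f g (suc n)) ⟩
  ↑ (suc n) * ∑< (2 ℕ.+ n) T                                           ≡⟨ ∑<-*ˡ (2 ℕ.+ n) (↑ (suc n)) ⟩
  ∑< (2 ℕ.+ n) (λ i → ↑ (suc n) * T i)                                 ≡⟨ ∑<-cong (2 ℕ.+ n) split ⟩
  ∑< (2 ℕ.+ n) (λ i → ↑ i * T i + ↑ (suc n ∸ i) * T i)                 ≡⟨ ∑<-+ (2 ℕ.+ n) ⟩
  ∑< (2 ℕ.+ n) (λ i → ↑ i * T i) + ∑< (2 ℕ.+ n) (λ i → ↑ (suc n ∸ i) * T i)  ≡⟨ cong₂ _+_ left right ⟩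
  (∂ f ⊗ g) n + (f ⊗ ∂ g) n                                            ∎
  where
  T : ℕ → ℚ
  T i = f i * g (suc n ∸ i)
  split : ∀ i → i < 2 ℕ.+ n → ↑ (suc n) * T i ≡ ↑ i * T i + ↑ (suc n ∸ i) * T i
  split i i<2+n = trans (cong (_* T i) (↑-∸ (ℕ.≤-pred i<2+n))) (ℚ.*-distribʳ-+ (T i) (↑ i) _)
  left : ∑< (2 ℕ.+ n) (λ i → ↑ i * T i) ≡ (∂ f ⊗ g) n
  left = begin
    ∑< (2 ℕ.+ n) (λ i → ↑ i * T i)                          ≡⟨ ∑<-suc (suc n) ⟩
    0ℚ * T 0 + ∑< (suc n) (λ i → ↑ (suc i) * T (suc i))     ≡⟨ cong (_+ ∑< (suc n) (λ i → ↑ (suc i) * T (suc i))) (ℚ.*-zeroˡ (T 0)) ⟩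
    0ℚ + ∑< (suc n) (λ i → ↑ (suc i) * T (suc i))           ≡⟨ ℚ.+-identityˡ _ ⟩
    ∑< (suc n) (λ i → ↑ (suc i) * (f (suc i) * g (n ∸ i)))  ≡⟨ ∑<-cong (suc n) (λ i _ → sym (ℚ.*-assoc (↑ (suc i)) _ _)) ⟩
    ∑< (suc n) (λ i → ∂ f i * g (n ∸ i))                    ≡⟨ ⊗-as-∑ (∂ f) g n ⟨
    (∂ f ⊗ g) n                                             ∎
  right : ∑< (2 ℕ.+ n) (λ i → ↑ (suc n ∸ i) * T i) ≡ (f ⊗ ∂ g) n
  right = begin
    ∑< (2 ℕ.+ n) (λ i → ↑ (suc n ∸ i) * T i)
      ≡⟨ ∑<-snoc (suc n) ⟩
    ∑< (suc n) (λ i → ↑ (suc n ∸ i) * T i) + ↑ (n ∸ n) * T (suc n)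
      ≡⟨ cong (∑< (suc n) (λ i → ↑ (suc n ∸ i) * T i) +_) (trans (cong (λ k → ↑ k * T (suc n)) (ℕ.n∸n≡0 n)) (ℚ.*-zeroˡ (T (suc n)))) ⟩
    ∑< (suc n) (λ i → ↑ (suc n ∸ i) * T i) + 0ℚ
      ≡⟨ ℚ.+-identityʳ _ ⟩
    ∑< (suc n) (λ i → ↑ (suc n ∸ i) * T i)
      ≡⟨ ∑<-cong (suc n) inner ⟩
    ∑< (suc n) (λ i → f i * ∂ g (n ∸ i))
      ≡⟨ ⊗-as-∑ f (∂ g) n ⟨
    (f ⊗ ∂ g) n
      ∎
    where
    inner : ∀ i → i < suc n → ↑ (suc n ∸ i) * T i ≡ f i * ∂ g (n ∸ i)
    inner i i<1+n = begin
      ↑ (suc n ∸ i) * (f i * g (suc n ∸ i))          ≡⟨ cong (λ k → ↑ k * (f i * g k)) (ℕ.+-∸-assoc 1 (ℕ.≤-pred i<1+n)) ⟩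
      ↑ (suc (n ∸ i)) * (f i * g (suc (n ∸ i)))      ≡⟨ x∙yz≈y∙xz (↑ (suc (n ∸ i))) (f i) _ ⟩
      f i * ∂ g (n ∸ i)                              ∎

∂-unique : ∀ c {f g} → f 0 ≡ g 0 → ∂ f ≗ c · f → ∂ g ≗ c · g → f ≗ g
∂-unique c f₀≡g₀ ∂f ∂g zero    = f₀≡g₀
∂-unique c {f} {g} f₀≡g₀ ∂f ∂g (suc n) = *-cancelˡ-↑suc n (begin
  ↑ (suc n) * f (suc n)  ≡⟨ ∂f n ⟩
  c * f n                ≡⟨ cong (c *_) (∂-unique c f₀≡g₀ ∂f ∂g n) ⟩
  c * g n                ≡⟨ ∂g n ⟨
  ↑ (suc n) * g (suc n)  ∎)

∂-family-unique : ∀ {F G : ℕ → PS} → (∀ j → F j 0 ≡ G j 0) →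
                  (∀ j → ∂ (F j) ≗ (↑ j · F j) ⊕ F (suc j)) → (∀ j → ∂ (G j) ≗ (↑ j · G j) ⊕ G (suc j)) →
                  ∀ j → F j ≗ G j
∂-family-unique F₀≡G₀ ∂F ∂G j zero    = F₀≡G₀ j
∂-family-unique {F} {G} F₀≡G₀ ∂F ∂G j (suc n) = *-cancelˡ-↑suc n (begin
  ↑ (suc n) * F j (suc n)       ≡⟨ ∂F j n ⟩
  ↑ j * F j n + F (suc j) n     ≡⟨ cong₂ (λ a b → ↑ j * a + b) (F≗G j n) (F≗G (suc j) n) ⟩
  ↑ j * G j n + G (suc j) n     ≡⟨ ∂G j n ⟨
  ↑ (suc n) * G j (suc n)       ∎)
  where
  F≗G : ∀ j → F j ≗ G j
  F≗G = ∂-family-unique F₀≡G₀ ∂F ∂G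

-- Exponentials

expX-as-* : ∀ a n → expX a n ≡ ↑ (a ℕ.^ n) * inv! n
expX-as-* a n = fraction-as-* (a ℕ.^ n) (n !) {{n !≢0}}

∂-expX : ∀ a → ∂ (expX a) ≗ ↑ a · expX a
∂-expX a n = begin
  ↑ (suc n) * expX a (suc n)                   ≡⟨ cong (↑ (suc n) *_) (expX-as-* a (suc n)) ⟩
  ↑ (suc n) * (↑ (a ℕ.* a ℕ.^ n) * inv! (suc n)) ≡⟨ cong (λ t → ↑ (suc n) * (t * inv! (suc n))) (↑-* a (a ℕ.^ n)) ⟩
  ↑ (suc n) * (↑ a * ↑ (a ℕ.^ n) * inv! (suc n)) ≡⟨ regroup (↑ (suc n)) (↑ a) _ _ ⟩
  ↑ a * (↑ (a ℕ.^ n) * (↑ (suc n) * inv! (suc n))) ≡⟨ cong (λ t → ↑ a * (↑ (a ℕ.^ n) * t)) (inv!-suc n) ⟩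
  ↑ a * (↑ (a ℕ.^ n) * inv! n)                 ≡⟨ cong (↑ a *_) (expX-as-* a n) ⟨
  ↑ a * expX a n                               ∎
  where
  regroup : ∀ s x y v → s * (x * y * v) ≡ x * (y * (s * v))
  regroup = solve 4 (λ s x y v → s :* (x :* y :* v) := x :* (y :* (s :* v))) refl

expX-0 : expX 0 ≗ const 1ℚ
expX-0 zero    = refl
expX-0 (suc n) = ℚ.0/n≡0 (suc n !) {{suc n !≢0}}

expX-+ : ∀ a b → expX a ⊗ expX b ≗ expX (a ℕ.+ b)
expX-+ a b = ∂-unique (↑ (a ℕ.+ b)) refl ∂-product (∂-expX (a ℕ.+ b))
  where
  ∂-product : ∂ (expX a ⊗ expX b) ≗ ↑ (a ℕ.+ b) · (expX a ⊗ expX b)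
  ∂-product n = begin
    ∂ (expX a ⊗ expX b) n
      ≡⟨ ∂-⊗ (expX a) (expX b) n ⟩
    (∂ (expX a) ⊗ expX b) n + (expX a ⊗ ∂ (expX b)) n
      ≡⟨ cong₂ _+_ (⊗-congˡ (expX b) (∂-expX a) n) (⊗-congʳ (expX a) (∂-expX b) n) ⟩
    ((↑ a · expX a) ⊗ expX b) n + (expX a ⊗ (↑ b · expX b)) n
      ≡⟨ cong₂ _+_ (⊗-·ˡ (↑ a) (expX a) (expX b) n) (⊗-·ʳ (expX a) (↑ b) (expX b) n) ⟩
    ↑ a * (expX a ⊗ expX b) n + ↑ b * (expX a ⊗ expX b) n
      ≡⟨ ℚ.*-distribʳ-+ _ (↑ a) (↑ b) ⟨
    (↑ a + ↑ b) * (expX a ⊗ expX b) n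
      ≡⟨ cong (_* (expX a ⊗ expX b) n) (↑-+ a b) ⟨
    ↑ (a ℕ.+ b) * (expX a ⊗ expX b) n
      ∎

pow-vanishes : ∀ g → g 0 ≡ 0ℚ → ∀ m i → i < m → pow g m i ≡ 0ℚ
pow-vanishes g g₀≡0 (suc m) i i<1+m = trans (⊗-as-∑ g (pow g m) i) (∑<-zero (suc i) (term i i<1+m))
  where
  term : ∀ i → i < suc m → ∀ j → j < suc i → g j * pow g m (i ∸ j) ≡ 0ℚ
  term i       _           zero    _         = trans (cong (_* pow g m i) g₀≡0) (ℚ.*-zeroˡ (pow g m i))
  term (suc i) (s≤s i<m) (suc j) (s≤s j≤i) =
    trans (cong (g (suc j) *_) (pow-vanishes g g₀≡0 m (i ∸ j) (ℕ.≤-<-trans (ℕ.m∸n≤m i j) i<m))) (ℚ.*-zeroʳ (g (suc j)))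

∂-pow : ∀ g m → ∂ (pow g (suc m)) ≗ ↑ (suc m) · (∂ g ⊗ pow g m)
∂-pow g m n = begin
  ∂ (g ⊗ pow g m) n                                ≡⟨ ∂-⊗ g (pow g m) n ⟩
  (∂ g ⊗ pow g m) n + (g ⊗ ∂ (pow g m)) n          ≡⟨ cong ((∂ g ⊗ pow g m) n +_) (g⊗∂pow m) ⟩
  (∂ g ⊗ pow g m) n + ↑ m * (∂ g ⊗ pow g m) n      ≡⟨ solve 2 (λ x a → x :+ a :* x := (con 1ℚ :+ a) :* x) refl _ (↑ m) ⟩
  ↑ (suc m) * (∂ g ⊗ pow g m) n                    ∎
  where
  g⊗∂pow : ∀ k → (g ⊗ ∂ (pow g k)) n ≡ ↑ k * (∂ g ⊗ pow g k) n
  g⊗∂pow zero    = trans (⊗-zeroʳ g (∂-const 1ℚ) n) (sym (ℚ.*-zeroˡ ((∂ g ⊗ pow g 0) n)))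
  g⊗∂pow (suc k) = begin
    (g ⊗ ∂ (pow g (suc k))) n                  ≡⟨ ⊗-congʳ g (∂-pow g k) n ⟩
    (g ⊗ (↑ (suc k) · (∂ g ⊗ pow g k))) n      ≡⟨ ⊗-·ʳ g (↑ (suc k)) (∂ g ⊗ pow g k) n ⟩
    ↑ (suc k) * (g ⊗ (∂ g ⊗ pow g k)) n        ≡⟨ cong (↑ (suc k) *_) (⊗-left-comm g (∂ g) (pow g k) n) ⟩
    ↑ (suc k) * (∂ g ⊗ pow g (suc k)) n        ∎

expS-as-∑< : ∀ g → g 0 ≡ 0ℚ → ∀ {N k} → k < N → expS g k ≡ ∑< N (λ m → inv! m * pow g m k)
expS-as-∑< g g₀≡0 {N} {k} k<N = begin
  expS g k                                     ≡⟨ Σ≤-as-∑< k _ ⟩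
  ∑< (suc k) (λ m → inv! m * pow g m k)        ≡⟨ ∑<-extend (λ m → inv! m * pow g m k) vanishes k<N ⟨
  ∑< N (λ m → inv! m * pow g m k)              ∎
  where
  vanishes : ∀ m → k < m → m < N → inv! m * pow g m k ≡ 0ℚ
  vanishes m k<m _ = trans (cong (inv! m *_) (pow-vanishes g g₀≡0 m k k<m)) (ℚ.*-zeroʳ (inv! m))

∂-expS : ∀ g → g 0 ≡ 0ℚ → ∂ (expS g) ≗ ∂ g ⊗ expS g
∂-expS g g₀≡0 n = begin
  ↑ (suc n) * expS g (suc n)                                           ≡⟨ cong (↑ (suc n) *_) (Σ≤-as-∑< (suc n) _) ⟩
  ↑ (suc n) * ∑< (2 ℕ.+ n) (λ m → inv! m * pow g m (suc n))            ≡⟨ ∑<-*ˡ (2 ℕ.+ n) (↑ (suc n)) ⟩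
  ∑< (2 ℕ.+ n) (λ m → ↑ (suc n) * (inv! m * pow g m (suc n)))          ≡⟨ ∑<-cong (2 ℕ.+ n) (λ m _ → x∙yz≈y∙xz (↑ (suc n)) (inv! m) _) ⟩
  ∑< (2 ℕ.+ n) (λ m → inv! m * ∂ (pow g m) n)                          ≡⟨ ∑<-suc (suc n) ⟩
  inv! 0 * ∂ (pow g 0) n + ∑< (suc n) (λ m → inv! (suc m) * ∂ (pow g (suc m)) n)
    ≡⟨ cong₂ _+_ (trans (cong (inv! 0 *_) (∂-const 1ℚ n)) (ℚ.*-zeroʳ (inv! 0))) (∑<-cong (suc n) (λ m _ → lower m)) ⟩
  0ℚ + ∑< (suc n) (λ m → inv! m * (∂ g ⊗ pow g m) n)                   ≡⟨ ℚ.+-identityˡ _ ⟩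
  ∑< (suc n) (λ m → inv! m * (∂ g ⊗ pow g m) n)                        ≡⟨ ∑<-cong (suc n) (λ m _ → ⊗-·ʳ (∂ g) (inv! m) (pow g m) n) ⟨
  ∑< (suc n) (λ m → (∂ g ⊗ (inv! m · pow g m)) n)                      ≡⟨ ⊗-∑ʳ (∂ g) (suc n) (λ m → inv! m · pow g m) n ⟨
  (∂ g ⊗ (λ k → ∑< (suc n) (λ m → inv! m * pow g m k))) n              ≡⟨ ⊗-congʳ-≤ (∂ g) n (λ k k≤n → sym (expS-as-∑< g g₀≡0 (s≤s k≤n))) ⟩
  (∂ g ⊗ expS g) n                                                     ∎
  where
  lower : ∀ m → inv! (suc m) * ∂ (pow g (suc m)) n ≡ inv! m * (∂ g ⊗ pow g m) n
  lower m = begin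
    inv! (suc m) * ∂ (pow g (suc m)) n               ≡⟨ cong (inv! (suc m) *_) (∂-pow g m n) ⟩
    inv! (suc m) * (↑ (suc m) * (∂ g ⊗ pow g m) n)   ≡⟨ ℚ.*-assoc (inv! (suc m)) _ _ ⟨
    (inv! (suc m) * ↑ (suc m)) * (∂ g ⊗ pow g m) n   ≡⟨ cong (_* (∂ g ⊗ pow g m) n) (trans (ℚ.*-comm (inv! (suc m)) _) (inv!-suc m)) ⟩
    inv! m * (∂ g ⊗ pow g m) n                       ∎

Bell : PS
Bell = expS (expX 1 ⊖ const 1ℚ)

∂-Bell : ∂ Bell ≗ expX 1 ⊗ Bell
∂-Bell n = trans (∂-expS (expX 1 ⊖ const 1ℚ) refl n) (⊗-congˡ Bell ∂-exponent n)
  where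
  ∂-exponent : ∂ (expX 1 ⊖ const 1ℚ) ≗ expX 1
  ∂-exponent k = begin
    ∂ (expX 1 ⊖ const 1ℚ) k         ≡⟨ ∂-⊖ (expX 1) (const 1ℚ) k ⟩
    ∂ (expX 1) k - ∂ (const 1ℚ) k   ≡⟨ cong₂ _-_ (∂-expX 1 k) (∂-const 1ℚ k) ⟩
    ↑ 1 * expX 1 k - 0ℚ             ≡⟨ solve 1 (λ x → (con 1ℚ :+ con 0ℚ) :* x :- con 0ℚ := x) refl (expX 1 k) ⟩
    expX 1 k                        ∎

∂-Bell⊗expX : ∀ j → ∂ (Bell ⊗ expX j) ≗ (↑ j · (Bell ⊗ expX j)) ⊕ (Bell ⊗ expX (suc j))
∂-Bell⊗expX j n = begin
  ∂ (Bell ⊗ expX j) n                                  ≡⟨ ∂-⊗ Bell (expX j) n ⟩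
  (∂ Bell ⊗ expX j) n + (Bell ⊗ ∂ (expX j)) n          ≡⟨ cong₂ _+_ (trans (⊗-congˡ (expX j) ∂-Bell n) raise) lower ⟩
  (Bell ⊗ expX (suc j)) n + ↑ j * (Bell ⊗ expX j) n    ≡⟨ ℚ.+-comm ((Bell ⊗ expX (suc j)) n) _ ⟩
  ↑ j * (Bell ⊗ expX j) n + (Bell ⊗ expX (suc j)) n    ∎
  where
  raise : ((expX 1 ⊗ Bell) ⊗ expX j) n ≡ (Bell ⊗ expX (suc j)) n
  raise = begin
    ((expX 1 ⊗ Bell) ⊗ expX j) n   ≡⟨ ⊗-assoc (expX 1) Bell (expX j) n ⟩
    (expX 1 ⊗ (Bell ⊗ expX j)) n   ≡⟨ ⊗-left-comm (expX 1) Bell (expX j) n ⟩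
    (Bell ⊗ (expX 1 ⊗ expX j)) n   ≡⟨ ⊗-congʳ Bell (expX-+ 1 j) n ⟩
    (Bell ⊗ expX (suc j)) n        ∎
  lower : (Bell ⊗ ∂ (expX j)) n ≡ ↑ j * (Bell ⊗ expX j) n
  lower = trans (⊗-congʳ Bell (∂-expX j) n) (⊗-·ʳ Bell (↑ j) (expX j) n)

-- Counting restricted growth sequences

∑ₗ-rgs-suc : ∀ n m (φ : List ℕ → ℚ) →
            ∑ₗ (rgs (suc n) m) φ ≡ ∑< m (λ i → ∑ₗ (rgs n m) (φ ∘ (suc i ∷_))) + ∑ₗ (rgs n (suc m)) (φ ∘ (suc m ∷_))
∑ₗ-rgs-suc n m φ = begin
  ∑ₗ (concatMap G (map suc (upTo (suc m)))) φ    ≡⟨ ∑ₗ-concatMap G (map suc (upTo (suc m))) φ ⟩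
  ∑ₗ (map suc (upTo (suc m))) H                  ≡⟨ ∑ₗ-map suc (upTo (suc m)) H ⟩
  ∑ₗ (upTo (suc m)) (H ∘ suc)                    ≡⟨ ∑ₗ-applyUpTo (λ i → i) (suc m) (H ∘ suc) ⟩
  ∑< (suc m) (H ∘ suc)                           ≡⟨ ∑<-snoc m ⟩
  ∑< m (H ∘ suc) + H (suc m)                     ≡⟨ cong₂ _+_ (∑<-cong m old) new ⟩
  ∑< m (λ i → ∑ₗ (rgs n m) (φ ∘ (suc i ∷_))) + ∑ₗ (rgs n (suc m)) (φ ∘ (suc m ∷_)) ∎
  where
  G : ℕ → List (List ℕ)
  G v = map (v ∷_) (rgs n (m ⊔ v))
  H : ℕ → ℚ
  H v = ∑ₗ (G v) φ
  old : ∀ i → i < m → H (suc i) ≡ ∑ₗ (rgs n m) (φ ∘ (suc i ∷_))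
  old i i<m = trans (∑ₗ-map (suc i ∷_) (rgs n (m ⊔ suc i)) φ)
                    (cong (λ k → ∑ₗ (rgs n k) (φ ∘ (suc i ∷_))) (ℕ.m≥n⇒m⊔n≡m i<m))
  new : H (suc m) ≡ ∑ₗ (rgs n (suc m)) (φ ∘ (suc m ∷_))
  new = trans (∑ₗ-map (suc m ∷_) (rgs n (m ⊔ suc m)) φ)
              (cong (λ k → ∑ₗ (rgs n k) (φ ∘ (suc m ∷_))) (ℕ.m≤n⇒m⊔n≡n (ℕ.n≤1+n m)))

count : ℕ → ℕ → ℚ
count n m = ∑ₗ (rgs n m) (λ _ → 1ℚ)

count-suc : ∀ n m → count (suc n) m ≡ ↑ m * count n m + count n (suc m)
count-suc n m = trans (∑ₗ-rgs-suc n m (λ _ → 1ℚ)) (cong (_+ count n (suc m)) (∑<-const m (count n m)))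

markedCount : ℕ → ℕ → ℚ
markedCount zero    m = 0ℚ
markedCount (suc n) m = ↑ (suc n) * count n m

markedCount-suc : ∀ n m → markedCount (suc n) m ≡ ↑ m * markedCount n m + markedCount n (suc m) + count n m
markedCount-suc zero    m = solve 2 (λ x c → (con 1ℚ :+ con 0ℚ) :* c := x :* con 0ℚ :+ con 0ℚ :+ c) refl (↑ m) (count 0 m)
markedCount-suc (suc n) m = begin
  ↑ (2 ℕ.+ n) * count (suc n) m
    ≡⟨ cong (↑ (2 ℕ.+ n) *_) (count-suc n m) ⟩
  ↑ (2 ℕ.+ n) * (↑ m * count n m + count n (suc m))
    ≡⟨ expand (↑ (suc n)) (↑ m) (count n m) (count n (suc m)) ⟩
  ↑ m * (↑ (suc n) * count n m) + ↑ (suc n) * count n (suc m) + (↑ m * count n m + count n (suc m))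
    ≡⟨ cong (↑ m * markedCount (suc n) m + markedCount (suc n) (suc m) +_) (count-suc n m) ⟨
  ↑ m * markedCount (suc n) m + markedCount (suc n) (suc m) + count (suc n) m
    ∎
  where
  expand : ∀ a x c₀ c₁ → (1ℚ + a) * (x * c₀ + c₁) ≡ x * (a * c₀) + a * c₁ + (x * c₀ + c₁)
  expand = solve 4 (λ a x c₀ c₁ → (con 1ℚ :+ a) :* (x :* c₀ :+ c₁) := x :* (a :* c₀) :+ a :* c₁ :+ (x :* c₀ :+ c₁)) refl

Bell⊗expX-coefficient : ∀ j n → (Bell ⊗ expX j) n ≡ count n j * inv! n
Bell⊗expX-coefficient = ∂-family-unique (λ _ → refl) ∂-Bell⊗expX ∂-counts
  where
  ∂-counts : ∀ j → ∂ (λ n → count n j * inv! n) ≗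
                   (↑ j · (λ n → count n j * inv! n)) ⊕ (λ n → count n (suc j) * inv! n)
  ∂-counts j n = begin
    ↑ (suc n) * (count (suc n) j * inv! (suc n))
      ≡⟨ x∙yz≈y∙xz (↑ (suc n)) (count (suc n) j) _ ⟩
    count (suc n) j * (↑ (suc n) * inv! (suc n))
      ≡⟨ cong₂ _*_ (count-suc n j) (inv!-suc n) ⟩
    (↑ j * count n j + count n (suc j)) * inv! n
      ≡⟨ solve 4 (λ a c₀ c₁ i → (a :* c₀ :+ c₁) :* i := a :* (c₀ :* i) :+ c₁ :* i) refl
        (↑ j) (count n j) (count n (suc j)) (inv! n) ⟩
    ↑ j * (count n j * inv! n) + count n (suc j) * inv! n
      ∎

Bell⊗X⊗expX-coefficient : ∀ j n → (Bell ⊗ (X ⊗ expX j)) n ≡ markedCount n j * inv! n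
Bell⊗X⊗expX-coefficient j n = trans (⊗-left-comm Bell X (expX j) n) (shifted n)
  where
  shifted : ∀ n → (X ⊗ (Bell ⊗ expX j)) n ≡ markedCount n j * inv! n
  shifted zero    = trans (X-⊗-zero (Bell ⊗ expX j)) (sym (ℚ.*-zeroˡ (inv! 0)))
  shifted (suc n) = begin
    (X ⊗ (Bell ⊗ expX j)) (suc n)
      ≡⟨ X-⊗-suc (Bell ⊗ expX j) n ⟩
    (Bell ⊗ expX j) n
      ≡⟨ Bell⊗expX-coefficient j n ⟩
    count n j * inv! n
      ≡⟨ cong (count n j *_) (inv!-suc n) ⟨
    count n j * (↑ (suc n) * inv! (suc n))
      ≡⟨ solve 3 (λ c a i → c :* (a :* i) := a :* c :* i) refl (count n j) (↑ (suc n)) (inv! (suc n)) ⟩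
    ↑ (suc n) * count n j * inv! (suc n)
      ∎

Bell-coefficient : ∀ n → Bell n ≡ count n 0 * inv! n
Bell-coefficient n = begin
  Bell n                   ≡⟨ ℚ.*-identityʳ (Bell n) ⟨
  Bell n * 1ℚ              ≡⟨ ⊗-constʳ Bell 1ℚ n ⟨
  (Bell ⊗ const 1ℚ) n      ≡⟨ ⊗-congʳ Bell expX-0 n ⟨
  (Bell ⊗ expX 0) n        ≡⟨ Bell⊗expX-coefficient 0 n ⟩
  count n 0 * inv! n       ∎

-- The total of sumelements

<ᵇ-false : ∀ {m n} → n ≤ m → (m <ᵇ n) ≡ false
<ᵇ-false {n = zero}    _         = refl
<ᵇ-false {suc m} {suc n} (s≤s n≤m) = <ᵇ-false n≤m

<ᵇ-suc : ∀ m → (m <ᵇ suc m) ≡ true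
<ᵇ-suc zero    = refl
<ᵇ-suc (suc m) = <ᵇ-suc m

sumelementsAux-old : ∀ {m i} s vs → i < m → sumelementsAux m s (suc i ∷ vs) ≡ sumelementsAux m (s ℕ.+ suc i) vs
sumelementsAux-old {m} {i} s vs i<m =
  cong₂ (λ b k → (if b then s else 0) ℕ.+ sumelementsAux k (s ℕ.+ suc i) vs) (<ᵇ-false i<m) (ℕ.m≥n⇒m⊔n≡m i<m)

sumelementsAux-record : ∀ m s vs → sumelementsAux m s (suc m ∷ vs) ≡ s ℕ.+ sumelementsAux (suc m) (s ℕ.+ suc m) vs
sumelementsAux-record m s vs =
  cong₂ (λ b k → (if b then s else 0) ℕ.+ sumelementsAux k (s ℕ.+ suc m) vs) (<ᵇ-suc m) (ℕ.m≤n⇒m⊔n≡n (ℕ.n≤1+n m))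

sumelementsFrom : ℕ → ℕ → ℕ → ℚ
sumelementsFrom n m s = ∑ₗ (rgs n m) (λ vs → ↑ (sumelementsAux m s vs))

sumelementsFrom-suc : ∀ n m s → sumelementsFrom (suc n) m s ≡
  ∑< m (λ i → sumelementsFrom n m (s ℕ.+ suc i)) + (↑ s * count n (suc m) + sumelementsFrom n (suc m) (s ℕ.+ suc m))
sumelementsFrom-suc n m s = trans (∑ₗ-rgs-suc n m (λ vs → ↑ (sumelementsAux m s vs))) (cong₂ _+_
  (∑<-cong m (λ i i<m → ∑ₗ-cong (rgs n m) (λ vs → cong ↑_ (sumelementsAux-old s vs i<m))))
  (trans (∑ₗ-cong (rgs n (suc m)) (λ vs → trans (cong ↑_ (sumelementsAux-record m s vs)) (↑-+ s _)))
         (∑ₗ-const-+ (rgs n (suc m)) (↑ s) _)))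

½ ⅓ ¾ ¹⁄₁₂ : ℚ
½ = ℤ.+ 1 / 2
⅓ = ℤ.+ 1 / 3
¾ = ℤ.+ 3 / 4
¹⁄₁₂ = ℤ.+ 1 / 12

-- Kept as solver syntax, so that each identity it satisfies below is a single call to solve.
sumelementsPolyᵉ : ∀ {k} (s m c₀ c₁ c₂ c₃ u₀ u₁ u₂ : Polynomial k) → Polynomial k
sumelementsPolyᵉ s m c₀ c₁ c₂ c₃ u₀ u₁ u₂ =
  s :* (c₁ :- c₀)
  :+ (con ⅓ :* c₃ :- con ½ :* u₂ :+ con ¾ :* c₂ :- u₁ :- c₁ :- con ¹⁄₁₂ :* c₀)
  :+ m :* (c₂ :- con ½ :* c₁ :- u₁ :- con ½ :* u₀ :- con ½ :* c₀)
  :+ m :* m :* (con ½ :* c₁ :- con ½ :* c₀ :- con ½ :* u₀)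

sumelementsPoly : (s m c₀ c₁ c₂ c₃ u₀ u₁ u₂ : ℚ) → ℚ
sumelementsPoly s m c₀ c₁ c₂ c₃ u₀ u₁ u₂ =
  ⟦ sumelementsPolyᵉ (var (# 0)) (var (# 1)) (var (# 2)) (var (# 3)) (var (# 4)) (var (# 5)) (var (# 6)) (var (# 7)) (var (# 8)) ⟧
    (s ∷ m ∷ c₀ ∷ c₁ ∷ c₂ ∷ c₃ ∷ u₀ ∷ u₁ ∷ u₂ ∷ [])

sumelementsPoly-base : ∀ s m → sumelementsPoly s m 1ℚ 1ℚ 1ℚ 1ℚ 0ℚ 0ℚ 0ℚ ≡ 0ℚ
sumelementsPoly-base = solve 2 (λ s m →
  sumelementsPolyᵉ s m (con 1ℚ) (con 1ℚ) (con 1ℚ) (con 1ℚ) (con 0ℚ) (con 0ℚ) (con 0ℚ) := con 0ℚ) refl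

sumelementsPoly-shift : ∀ s k m c₀ c₁ c₂ c₃ u₀ u₁ u₂ →
  sumelementsPoly (s + k) m c₀ c₁ c₂ c₃ u₀ u₁ u₂ ≡ sumelementsPoly s m c₀ c₁ c₂ c₃ u₀ u₁ u₂ + k * (c₁ - c₀)
sumelementsPoly-shift = solve 10 (λ s k m c₀ c₁ c₂ c₃ u₀ u₁ u₂ →
  sumelementsPolyᵉ (s :+ k) m c₀ c₁ c₂ c₃ u₀ u₁ u₂ := sumelementsPolyᵉ s m c₀ c₁ c₂ c₃ u₀ u₁ u₂ :+ k :* (c₁ :- c₀)) refl

-- The recurrence of sumelementsFrom-suc, with the counts at level n + 1 expanded by
-- count-suc and markedCount-suc.
sumelementsPoly-step : ∀ s m c₀ c₁ c₂ c₃ c₄ u₀ u₁ u₂ u₃ →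
  m * sumelementsPoly s m c₀ c₁ c₂ c₃ u₀ u₁ u₂ + ½ * (m * (1ℚ + m)) * (c₁ - c₀)
    + (s * c₁ + sumelementsPoly (s + (1ℚ + m)) (1ℚ + m) c₁ c₂ c₃ c₄ u₁ u₂ u₃)
  ≡ sumelementsPoly s m (m * c₀ + c₁) ((1ℚ + m) * c₁ + c₂) ((1ℚ + (1ℚ + m)) * c₂ + c₃) ((1ℚ + (1ℚ + (1ℚ + m))) * c₃ + c₄)
                        (m * u₀ + u₁ + c₀) ((1ℚ + m) * u₁ + u₂ + c₁) ((1ℚ + (1ℚ + m)) * u₂ + u₃ + c₂)
sumelementsPoly-step = solve 11 (λ s m c₀ c₁ c₂ c₃ c₄ u₀ u₁ u₂ u₃ →
  m :* sumelementsPolyᵉ s m c₀ c₁ c₂ c₃ u₀ u₁ u₂ :+ con ½ :* (m :* (con 1ℚ :+ m)) :* (c₁ :- c₀)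
    :+ (s :* c₁ :+ sumelementsPolyᵉ (s :+ (con 1ℚ :+ m)) (con 1ℚ :+ m) c₁ c₂ c₃ c₄ u₁ u₂ u₃)
  := sumelementsPolyᵉ s m (m :* c₀ :+ c₁) ((con 1ℚ :+ m) :* c₁ :+ c₂) ((con 1ℚ :+ (con 1ℚ :+ m)) :* c₂ :+ c₃)
                          ((con 1ℚ :+ (con 1ℚ :+ (con 1ℚ :+ m))) :* c₃ :+ c₄)
                          (m :* u₀ :+ u₁ :+ c₀) ((con 1ℚ :+ m) :* u₁ :+ u₂ :+ c₁) ((con 1ℚ :+ (con 1ℚ :+ m)) :* u₂ :+ u₃ :+ c₂))
  refl

sumelementsPoly-cong : ∀ s m {c₀ c₀′ c₁ c₁′ c₂ c₂′ c₃ c₃′ u₀ u₀′ u₁ u₁′ u₂ u₂′} →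
  c₀ ≡ c₀′ → c₁ ≡ c₁′ → c₂ ≡ c₂′ → c₃ ≡ c₃′ → u₀ ≡ u₀′ → u₁ ≡ u₁′ → u₂ ≡ u₂′ →
  sumelementsPoly s m c₀ c₁ c₂ c₃ u₀ u₁ u₂ ≡ sumelementsPoly s m c₀′ c₁′ c₂′ c₃′ u₀′ u₁′ u₂′
sumelementsPoly-cong s m refl refl refl refl refl refl refl = refl

sumelementsClosedForm : ℕ → ℕ → ℕ → ℚ
sumelementsClosedForm n m s = sumelementsPoly (↑ s) (↑ m) (c 0) (c 1) (c 2) (c 3) (u 0) (u 1) (u 2)
  where
  c u : ℕ → ℚ
  c j = count n (j ℕ.+ m)
  u j = markedCount n (j ℕ.+ m)

∑<-↑suc : ∀ m → ∑< m (λ i → ↑ (suc i)) ≡ ½ * (↑ m * (1ℚ + ↑ m))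
∑<-↑suc zero    = ∑<-empty
∑<-↑suc (suc m) = begin
  ∑< (suc m) (λ i → ↑ (suc i))                   ≡⟨ ∑<-snoc m ⟩
  ∑< m (λ i → ↑ (suc i)) + ↑ (suc m)             ≡⟨ cong (_+ ↑ (suc m)) (∑<-↑suc m) ⟩
  ½ * (↑ m * (1ℚ + ↑ m)) + (1ℚ + ↑ m)            ≡⟨ solve 1 (λ x → con ½ :* (x :* (con 1ℚ :+ x)) :+ (con 1ℚ :+ x)
                                                      := con ½ :* ((con 1ℚ :+ x) :* (con 1ℚ :+ (con 1ℚ :+ x)))) refl (↑ m) ⟩
  ½ * (↑ (suc m) * (1ℚ + ↑ (suc m)))             ∎

∑<-arithmetic : ∀ m a r → ∑< m (λ i → a + ↑ (suc i) * r) ≡ ↑ m * a + ½ * (↑ m * (1ℚ + ↑ m)) * r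
∑<-arithmetic m a r = begin
  ∑< m (λ i → a + ↑ (suc i) * r)               ≡⟨ ∑<-+ m ⟩
  ∑< m (λ _ → a) + ∑< m (λ i → ↑ (suc i) * r)  ≡⟨ cong₂ _+_ (∑<-const m a) (sym (∑<-*ʳ m r)) ⟩
  ↑ m * a + ∑< m (λ i → ↑ (suc i)) * r         ≡⟨ cong (λ t → ↑ m * a + t * r) (∑<-↑suc m) ⟩
  ↑ m * a + ½ * (↑ m * (1ℚ + ↑ m)) * r         ∎

sumelementsFrom-closed : ∀ n m s → sumelementsFrom n m s ≡ sumelementsClosedForm n m s
sumelementsFrom-closed zero    m s = sym (sumelementsPoly-base (↑ s) (↑ m))
sumelementsFrom-closed (suc n) m s = begin
  sumelementsFrom (suc n) m s
    ≡⟨ sumelementsFrom-suc n m s ⟩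
  ∑< m (λ i → sumelementsFrom n m (s ℕ.+ suc i)) + (↑ s * c 1 + sumelementsFrom n (suc m) (s ℕ.+ suc m))
    ≡⟨ cong₂ _+_ (∑<-cong m (λ i _ → old i)) (cong (↑ s * c 1 +_) new) ⟩
  ∑< m (λ i → P₀ + ↑ (suc i) * (c 1 - c 0)) + (↑ s * c 1 + P₁)
    ≡⟨ cong (_+ (↑ s * c 1 + P₁)) (∑<-arithmetic m P₀ (c 1 - c 0)) ⟩
  ↑ m * P₀ + ½ * (↑ m * (1ℚ + ↑ m)) * (c 1 - c 0) + (↑ s * c 1 + P₁)
    ≡⟨ sumelementsPoly-step (↑ s) (↑ m) (c 0) (c 1) (c 2) (c 3) (c 4) (u 0) (u 1) (u 2) (u 3) ⟩
  sumelementsPoly (↑ s) (↑ m) (↑ m * c 0 + c 1) (↑ (1 ℕ.+ m) * c 1 + c 2) (↑ (2 ℕ.+ m) * c 2 + c 3) (↑ (3 ℕ.+ m) * c 3 + c 4)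
                  (↑ m * u 0 + u 1 + c 0) (↑ (1 ℕ.+ m) * u 1 + u 2 + c 1) (↑ (2 ℕ.+ m) * u 2 + u 3 + c 2)
    ≡⟨ sumelementsPoly-cong (↑ s) (↑ m) (count-suc n m) (count-suc n (1 ℕ.+ m)) (count-suc n (2 ℕ.+ m)) (count-suc n (3 ℕ.+ m))
         (markedCount-suc n m) (markedCount-suc n (1 ℕ.+ m)) (markedCount-suc n (2 ℕ.+ m)) ⟨
  sumelementsClosedForm (suc n) m s
    ∎
  where
  c u : ℕ → ℚ
  c j = count n (j ℕ.+ m)
  u j = markedCount n (j ℕ.+ m)
  P₀ P₁ : ℚ
  P₀ = sumelementsPoly (↑ s) (↑ m) (c 0) (c 1) (c 2) (c 3) (u 0) (u 1) (u 2)
  P₁ = sumelementsPoly (↑ s + ↑ (suc m)) (↑ (suc m)) (c 1) (c 2) (c 3) (c 4) (u 1) (u 2) (u 3)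
  old : ∀ i → sumelementsFrom n m (s ℕ.+ suc i) ≡ P₀ + ↑ (suc i) * (c 1 - c 0)
  old i = begin
    sumelementsFrom n m (s ℕ.+ suc i)
      ≡⟨ sumelementsFrom-closed n m (s ℕ.+ suc i) ⟩
    sumelementsClosedForm n m (s ℕ.+ suc i)
      ≡⟨ cong (λ t → sumelementsPoly t (↑ m) (c 0) (c 1) (c 2) (c 3) (u 0) (u 1) (u 2)) (↑-+ s (suc i)) ⟩
    sumelementsPoly (↑ s + ↑ (suc i)) (↑ m) (c 0) (c 1) (c 2) (c 3) (u 0) (u 1) (u 2)
                                               ≡⟨ sumelementsPoly-shift (↑ s) (↑ (suc i)) (↑ m) (c 0) (c 1) (c 2) (c 3) (u 0) (u 1) (u 2) ⟩
    P₀ + ↑ (suc i) * (c 1 - c 0)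
      ∎
  new : sumelementsFrom n (suc m) (s ℕ.+ suc m) ≡ P₁
  new = trans (sumelementsFrom-closed n (suc m) (s ℕ.+ suc m))
              (cong (λ t → sumelementsPoly t (↑ (suc m)) (c 1) (c 2) (c 3) (c 4) (u 1) (u 2) (u 3)) (↑-+ s (suc m)))

rhs-coefficient : ∀ n → rhs n ≡ sumelementsClosedForm n 0 0 * inv! n
rhs-coefficient n = begin
  (Bell ⊗ (H₅ ⊖ const ¹⁄₁₂)) n
    ≡⟨ ⊗-distribˡ-⊖ Bell H₅ (const ¹⁄₁₂) n ⟩
  (Bell ⊗ H₅) n - (Bell ⊗ const ¹⁄₁₂) n
    ≡⟨ cong₂ _-_ (⊗-distribˡ-⊖ Bell H₄ (expX 1) n) (⊗-constʳ Bell ¹⁄₁₂ n) ⟩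
  (Bell ⊗ H₄) n - W 1 - Bell n * ¹⁄₁₂
    ≡⟨ cong (λ x → x - W 1 - Bell n * ¹⁄₁₂) (⊗-distribˡ-⊖ Bell H₃ (X ⊗ expX 1) n) ⟩
  (Bell ⊗ H₃) n - XW 1 - W 1 - Bell n * ¹⁄₁₂
    ≡⟨ cong (λ x → x - XW 1 - W 1 - Bell n * ¹⁄₁₂) (⊗-distribˡ-⊕ Bell H₂ (¾ · expX 2) n) ⟩
  (Bell ⊗ H₂) n + (Bell ⊗ (¾ · expX 2)) n - XW 1 - W 1 - Bell n * ¹⁄₁₂
    ≡⟨ cong₂ (λ x y → x + y - XW 1 - W 1 - Bell n * ¹⁄₁₂)
             (⊗-distribˡ-⊖ Bell (⅓ · expX 3) (½ · (X ⊗ expX 2)) n) (⊗-·ʳ Bell ¾ (expX 2) n) ⟩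
  (Bell ⊗ (⅓ · expX 3)) n - (Bell ⊗ (½ · (X ⊗ expX 2))) n + ¾ * W 2 - XW 1 - W 1 - Bell n * ¹⁄₁₂
    ≡⟨ cong₂ (λ x y → x - y + ¾ * W 2 - XW 1 - W 1 - Bell n * ¹⁄₁₂)
             (⊗-·ʳ Bell ⅓ (expX 3) n) (⊗-·ʳ Bell ½ (X ⊗ expX 2) n) ⟩
  ⅓ * W 3 - ½ * XW 2 + ¾ * W 2 - XW 1 - W 1 - Bell n * ¹⁄₁₂
    ≡⟨ substitute (Bell⊗expX-coefficient 3 n) (Bell⊗X⊗expX-coefficient 2 n) (Bell⊗expX-coefficient 2 n)
                  (Bell⊗X⊗expX-coefficient 1 n) (Bell⊗expX-coefficient 1 n) (Bell-coefficient n) ⟩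
  ⅓ * (C 3 * i) - ½ * (U 2 * i) + ¾ * (C 2 * i) - U 1 * i - C 1 * i - C 0 * i * ¹⁄₁₂
    ≡⟨ solve 8 (λ c₀ c₁ c₂ c₃ u₀ u₁ u₂ i →
         con ⅓ :* (c₃ :* i) :- con ½ :* (u₂ :* i) :+ con ¾ :* (c₂ :* i) :- u₁ :* i :- c₁ :* i :- c₀ :* i :* con ¹⁄₁₂
         := sumelementsPolyᵉ (con 0ℚ) (con 0ℚ) c₀ c₁ c₂ c₃ u₀ u₁ u₂ :* i) refl (C 0) (C 1) (C 2) (C 3) (U 0) (U 1) (U 2) i ⟩
  sumelementsClosedForm n 0 0 * inv! n
    ∎
  where
  H₂ H₃ H₄ H₅ : PS
  H₂ = (⅓ · expX 3) ⊖ (½ · (X ⊗ expX 2))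
  H₃ = H₂ ⊕ (¾ · expX 2)
  H₄ = H₃ ⊖ (X ⊗ expX 1)
  H₅ = H₄ ⊖ expX 1
  W XW C U : ℕ → ℚ
  W j = (Bell ⊗ expX j) n
  XW j = (Bell ⊗ (X ⊗ expX j)) n
  C j = count n j
  U j = markedCount n j
  i : ℚ
  i = inv! n
  substitute : ∀ {a a′ b b′ c c′ d d′ e e′ f f′} → a ≡ a′ → b ≡ b′ → c ≡ c′ → d ≡ d′ → e ≡ e′ → f ≡ f′ →
               ⅓ * a - ½ * b + ¾ * c - d - e - f * ¹⁄₁₂ ≡ ⅓ * a′ - ½ * b′ + ¾ * c′ - d′ - e′ - f′ * ¹⁄₁₂
  substitute refl refl refl refl refl refl = refl

↑-sum : ∀ {A : Set} (f : A → ℕ) L → ↑ (foldr ℕ._+_ 0 (map f L)) ≡ ∑ₗ L (↑_ ∘ f)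
↑-sum f []      = refl
↑-sum f (x ∷ L) = trans (↑-+ (f x) _) (cong (↑ (f x) +_) (↑-sum f L))

theorem3 : (n : ℕ) → dPdq-at-1 n ≡ rhs n
theorem3 n = begin
  dPdq-at-1 n                                                    ≡⟨ fraction-as-* total (n !) {{n !≢0}} ⟩
  ↑ total * inv! n                                               ≡⟨ cong (_* inv! n) (↑-sum sumelements (partitions n)) ⟩
  sumelementsFrom n 0 0 * inv! n                                 ≡⟨ cong (_* inv! n) (sumelementsFrom-closed n 0 0) ⟩
  sumelementsClosedForm n 0 0 * inv! n                                      ≡⟨ rhs-coefficient n ⟨
  rhs n                                                          ∎
  where
  total : ℕ
  total = foldr ℕ._+_ 0 (map sumelements (partitions n))
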